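{- Let $r,d,q$ be positive integers. Every sequence of $n\ge(\lceil q/r\rceil+2)(2rd+1)^d$ elements of $[-r,r]^d$ whose sum $z$ lies in $[-q,q]^d$ contains a subsequence of length at most $(\lceil q/r\rceil+2)(2rd+1)^d$ whose sum is $z$.
   Context: $[-r,r]^d$ denotes the set of $d$-dimensional integer vectors all of whose coordinates lie in $\{ -r,\ldots,r\}$; similarly $[-q,q]^d$. A subsequence is given by a subset of the positions of the sequence. -}

module Defs where

open import Data.Nat as ℕ using (ℕ; suc; _∸_; NonZero)
open import Data.Nat.DivMod using (_/_)
open import Data.Integer as ℤ using (ℤ; +_; -_)
open import Data.Fin using (Fin; zero; suc)
open import Data.Fin.Subset using (Subset; _∈_)
open import Data.Vec using (Vec; []; _∷_; replicate; zipWith; lookup)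
open import Data.Bool using (Bool; true; false)

Pt : ℕ → Set
Pt d = Vec ℤ d

0ᵈ : ∀ {d} → Pt d
0ᵈ = replicate _ (+ 0)

_+ᵈ_ : ∀ {d} → Pt d → Pt d → Pt d
u +ᵈ v = zipWith ℤ._+_ u v

InBox : ∀ {d} → ℕ → Pt d → Set
InBox r v = ∀ i → (- (+ r)) ℤ.≤ lookup v i × lookup v i ℤ.≤ + r
  where open import Data.Product using (_×_)

sumSeq : ∀ {d n} → (Fin n → Pt d) → Pt d
sumSeq {n = 0} s = 0ᵈ
sumSeq {n = suc n} s = s zero +ᵈ sumSeq (λ i → s (suc i))

sumSub : ∀ {d n} → (Fin n → Pt d) → Subset n → Pt d
sumSub {n = 0} s [] = 0ᵈ
sumSub {n = suc n} s (true ∷ S) = s zero +ᵈ sumSub (λ i → s (suc i)) S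
sumSub {n = suc n} s (false ∷ S) = sumSub (λ i → s (suc i)) S

ceilDiv : (q r : ℕ) → .{{NonZero r}} → ℕ
ceilDiv q r = (q ℕ.+ (r ∸ 1)) / r

bound : (r d q : ℕ) → .{{NonZero r}} → ℕ
bound r d q = (ceilDiv q r ℕ.+ 2) ℕ.* ((2 ℕ.* r ℕ.* d ℕ.+ 1) ℕ.^ d)

module Submission where

-- Append to the sequence s₁, …, sₙ ∈ [-r, r]^d (with sum z ∈ [-q, q]^d)
-- k = ⌈q/r⌉ "special" vectors in [-r, r]^d summing to −z. A subsequence S
-- with sum z then becomes, together with the special vectors, a zero-sum
-- family. The key lemma (zero-sum-part) says that a zero-sum family of vectors
-- in [-r, r]^d with at most K special members and at least (2rd + 1)^d·(K + 1)
-- members contains a nonempty zero-sum subfamily with no special member;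
-- removing it from S keeps the sum z, and iterating shortens S below the bound.
--
-- The key lemma is a Steinitz-type argument. A zero-sum family A admits a
-- chain A = A₀ ⊃ A₁ ⊃ ⋯ ⊃ A_|A| removing one element at a time such that
-- every A_t carries a point of the polytope
--   P(A_t, |A_t| − d) = { x ∈ [0,1]^A_t : ∑ xᵢ uᵢ = 0, ∑ xᵢ = |A_t| − d },
-- which forces ∑_{A_t} uᵢ = ∑ (1 − xᵢ) uᵢ ∈ [-rd, rd]^d. An element to remove
-- is found by moving the rescaled point to a vertex (pivoting along integer
-- kernel vectors obtained by Gaussian elimination), where some coordinate
-- vanishes. Pigeonhole on (sum of A_t, number of special members of A_t) then
-- gives a < b with A_a ∖ A_b the desired subfamily.

open import Defs
open import Data.Nat as ℕ using (ℕ; zero; suc; NonZero)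
import Data.Nat.Properties as ℕP
open import Data.Nat.DivMod using (_%_; m≡m%n+[m/n]*n; m%n<n)
import Data.Nat.Tactic.RingSolver as ℕSolver
open import Data.Integer as ℤ using (ℤ; +_; -[1+_]; _+_; _*_; -_; _-_; _≤_; +≤+)
import Data.Integer.Properties as ℤP
open import Algebra.Bundles using (AbelianGroup)
open import Algebra.Properties.Group (AbelianGroup.group ℤP.+-0-abelianGroup) using (∙-cancelˡ; ∙-cancelʳ)
open import Data.Integer.Tactic.RingSolver using (solve-∀)
open import Data.Rational.Unnormalised.Base using (ℚᵘ; mkℚᵘ; *≤*) renaming (_≤_ to _≤ℚ_)
import Data.Rational.Unnormalised.Properties as ℚP
open import Data.Fin using (Fin; zero; suc; toℕ; fromℕ<; combine; _↑ˡ_; _↑ʳ_; splitAt)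
import Data.Fin.Properties as FinP
open import Data.Fin.Subset using (Subset; ∣_∣)
open import Data.Vec using (lookup; tabulate)
open import Data.Vec.Functional using (_++_)
import Data.Vec.Functional.Properties as VecFP
import Data.Vec.Properties as VecP
open import Data.Bool as Bool using (Bool; true; false; _∧_; not)
import Data.Bool.Properties as BoolP
open import Function using (_∘′_)
open import Data.Product using (Σ; Σ-syntax; ∃; _×_; _,_; proj₁; proj₂)
open import Data.Sum using (_⊎_; inj₁; inj₂)
open import Data.Empty using (⊥; ⊥-elim)
open import Relation.Nullary using (yes; no; Dec; ¬?)
open import Relation.Nullary.Decidable using (does; dec-true; dec-false; _×-dec_)
open import Relation.Binary.PropositionalEquality

∑ : ∀ {N} → (Fin N → ℤ) → ℤ
∑ {zero}  f = + 0
∑ {suc N} f = f zero + ∑ (λ i → f (suc i))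

∑-cong : ∀ {N} {f g : Fin N → ℤ} → (∀ i → f i ≡ g i) → ∑ f ≡ ∑ g
∑-cong {zero}  e = refl
∑-cong {suc N} e = cong₂ _+_ (e zero) (∑-cong (λ i → e (suc i)))

∑-+ : ∀ {N} (f g : Fin N → ℤ) → ∑ (λ i → f i + g i) ≡ ∑ f + ∑ g
∑-+ {zero}  f g = refl
∑-+ {suc N} f g rewrite ∑-+ (λ i → f (suc i)) (λ i → g (suc i)) =
  interchange (f zero) (g zero) (∑ (λ i → f (suc i))) (∑ (λ i → g (suc i)))
  where
  interchange : ∀ a b c e → a + b + (c + e) ≡ a + c + (b + e)
  interchange = solve-∀

∑-*ˡ : ∀ {N} (c : ℤ) (f : Fin N → ℤ) → ∑ (λ i → c * f i) ≡ c * ∑ f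
∑-*ˡ {zero}  c f = sym (ℤP.*-zeroʳ c)
∑-*ˡ {suc N} c f rewrite ∑-*ˡ c (λ i → f (suc i)) = sym (ℤP.*-distribˡ-+ c (f zero) _)

∑-zero : ∀ {N} (f : Fin N → ℤ) → (∀ i → f i ≡ + 0) → ∑ f ≡ + 0
∑-zero {zero}  f e = refl
∑-zero {suc N} f e rewrite e zero | ∑-zero (λ i → f (suc i)) (λ i → e (suc i)) = refl

∑-mono : ∀ {N} {f g : Fin N → ℤ} → (∀ i → f i ≤ g i) → ∑ f ≤ ∑ g
∑-mono {zero}  e = ℤP.≤-refl
∑-mono {suc N} e = ℤP.+-mono-≤ (e zero) (∑-mono (λ i → e (suc i)))

∑-single : ∀ {N} (f : Fin N → ℤ) (j : Fin N) → (∀ i → i ≢ j → f i ≡ + 0) → ∑ f ≡ f j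
∑-single {suc N} f zero e
  rewrite ∑-zero (λ i → f (suc i)) (λ i → e (suc i) (λ ())) = ℤP.+-identityʳ (f zero)
∑-single {suc N} f (suc j) e
  rewrite e zero (λ ()) | ∑-single (λ i → f (suc i)) j (λ i i≢j → e (suc i) (i≢j ∘′ FinP.suc-injective)) =
  ℤP.+-identityˡ (f (suc j))

∑-split : ∀ n {k} (f : Fin (n ℕ.+ k) → ℤ) → ∑ f ≡ ∑ (λ i → f (i ↑ˡ k)) + ∑ (λ t → f (n ↑ʳ t))
∑-split zero    f = sym (ℤP.+-identityˡ _)
∑-split (suc n) f = trans (cong (λ s → f zero + s) (∑-split n (λ i → f (suc i)))) (sym (ℤP.+-assoc (f zero) _ _))

Sel : ℕ → Set
Sel N = Fin N → Bool

infix 4 _⊆_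
_⊆_ : ∀ {N} → Sel N → Sel N → Set
B ⊆ A = ∀ i → B i ≡ true → A i ≡ true

infixl 7 _∩_
_∩_ : ∀ {N} → Sel N → Sel N → Sel N
(A ∩ B) i = A i ∧ B i

infixl 6 _∖_
_∖_ : ∀ {N} → Sel N → Sel N → Sel N
(A ∖ B) i = A i ∧ not (B i)

⦅_⦆ : ∀ {N} → Fin N → Sel N
⦅ j ⦆ i = does (i FinP.≟ j)

⦅⦆-self : ∀ {N} (j : Fin N) → ⦅ j ⦆ j ≡ true
⦅⦆-self j = dec-true (j FinP.≟ j) refl

⦅⦆-other : ∀ {N} {i j : Fin N} → i ≢ j → ⦅ j ⦆ i ≡ false
⦅⦆-other {i = i} {j} i≢j = dec-false (i FinP.≟ j) i≢j

⦅⦆-sound : ∀ {N} {i j : Fin N} → ⦅ j ⦆ i ≡ true → i ≡ j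
⦅⦆-sound {i = i} {j} e with i FinP.≟ j
... | yes i≡j = i≡j

∖-⊆ : ∀ {N} (A B : Sel N) → A ∖ B ⊆ A
∖-⊆ A B i e with A i
... | true = refl

∖-false : ∀ {a b} → a ≡ false ⊎ b ≡ true → a ∧ not b ≡ false
∖-false {b = b} (inj₁ refl) = refl
∖-false {a} (inj₂ refl) = BoolP.∧-zeroʳ a

∖-false⁻¹ : ∀ a b → a ∧ not b ≡ false → a ≡ false ⊎ b ≡ true
∖-false⁻¹ false b    _ = inj₁ refl
∖-false⁻¹ true  true _ = inj₂ refl

∧-true : ∀ {a b} → a ∧ b ≡ true → a ≡ true × b ≡ true
∧-true {true} {true} e = refl , refl

∩-mono : ∀ {N} {A B C : Sel N} → B ⊆ A → B ∩ C ⊆ A ∩ C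
∩-mono {A = A} {B} {C} B⊆A i x = cong₂ _∧_ (B⊆A i (proj₁ (∧-true {B i} x))) (proj₂ (∧-true {B i} x))

true≢false : ∀ {b} → b ≡ true → b ≡ false → ⊥
true≢false refl ()

not-true : ∀ b → (b ≡ true → ⊥) → b ≡ false
not-true true  ¬t = ⊥-elim (¬t refl)
not-true false ¬t = refl

not-false : ∀ b → (b ≡ false → ⊥) → b ≡ true
not-false true  ¬f = refl
not-false false ¬f = ⊥-elim (¬f refl)

bool→ℕ : Bool → ℕ
bool→ℕ true  = 1
bool→ℕ false = 0

count : ∀ {N} → Sel N → ℕ
count {zero}  A = 0
count {suc N} A = bool→ℕ (A zero) ℕ.+ count (λ i → A (suc i))

count-cong : ∀ {N} {A B : Sel N} → (∀ i → A i ≡ B i) → count A ≡ count B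
count-cong {zero}  e = refl
count-cong {suc N} e = cong₂ ℕ._+_ (cong bool→ℕ (e zero)) (count-cong (λ i → e (suc i)))

count-≤ : ∀ {N} (A : Sel N) → count A ℕ.≤ N
count-≤ {zero}  A = ℕ.z≤n
count-≤ {suc N} A with A zero
... | true  = ℕ.s≤s (count-≤ (λ i → A (suc i)))
... | false = ℕP.m≤n⇒m≤1+n (count-≤ (λ i → A (suc i)))

count-full : ∀ N → count {N} (λ _ → true) ≡ N
count-full zero    = refl
count-full (suc N) = cong suc (count-full N)

count-empty : ∀ {N} (A : Sel N) → (∀ i → A i ≡ false) → count A ≡ 0
count-empty {zero}  A e = refl
count-empty {suc N} A e rewrite e zero = count-empty (λ i → A (suc i)) (λ i → e (suc i))

count-witness : ∀ {N} (A : Sel N) → 0 ℕ.< count A → ∃ λ i → A i ≡ true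
count-witness {suc N} A pos with A zero in e
... | true  = zero , e
... | false with count-witness (λ i → A (suc i)) pos
... | i , a = suc i , a

count-member : ∀ {N} (A : Sel N) (j : Fin N) → A j ≡ true → 1 ℕ.≤ count A
count-member {suc N} A zero    a rewrite a = ℕ.s≤s ℕ.z≤n
count-member {suc N} A (suc j) a =
  ℕP.≤-trans (count-member (λ i → A (suc i)) j a) (ℕP.m≤n+m _ (bool→ℕ (A zero)))

count-zero : ∀ {N} (A : Sel N) → count A ≡ 0 → ∀ i → A i ≡ false
count-zero A c0 i = not-true (A i) (λ a → ℕP.<⇒≢ (count-member A i a) (sym c0))

count-∩-∖ : ∀ {N} (A B : Sel N) → count A ≡ count (A ∩ B) ℕ.+ count (A ∖ B)
count-∩-∖ {zero}  A B = refl
count-∩-∖ {suc N} A B with A zero | B zero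
... | true  | true  = cong suc (count-∩-∖ (λ i → A (suc i)) (λ i → B (suc i)))
... | true  | false = trans (cong suc (count-∩-∖ (λ i → A (suc i)) (λ i → B (suc i)))) (sym (ℕP.+-suc _ _))
... | false | _     = count-∩-∖ (λ i → A (suc i)) (λ i → B (suc i))

∩-⊆ : ∀ {N} {A B : Sel N} → B ⊆ A → ∀ i → (A ∩ B) i ≡ B i
∩-⊆ {A = A} {B} B⊆A i with B i in b
... | true  rewrite B⊆A i b = refl
... | false with A i
... | true  = refl
... | false = refl

count-⊆ : ∀ {N} {A B : Sel N} → B ⊆ A → count A ≡ count B ℕ.+ count (A ∖ B)
count-⊆ {A = A} {B} B⊆A = trans (count-∩-∖ A B) (cong (ℕ._+ count (A ∖ B)) (count-cong (∩-⊆ B⊆A)))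

count-mono : ∀ {N} {A B : Sel N} → B ⊆ A → count B ℕ.≤ count A
count-mono {A = A} {B} B⊆A rewrite count-⊆ B⊆A = ℕP.m≤m+n (count B) _

count-single : ∀ {N} (A : Sel N) (j : Fin N) → A j ≡ true → (∀ i → i ≢ j → A i ≡ false) → count A ≡ 1
count-single {suc N} A zero a others
  rewrite a | count-empty (λ i → A (suc i)) (λ i → others (suc i) (λ ())) = refl
count-single {suc N} A (suc j) a others rewrite others zero (λ ()) =
  count-single (λ i → A (suc i)) j a (λ i i≢j → others (suc i) (i≢j ∘′ FinP.suc-injective))

count-remove : ∀ {N} (A : Sel N) (j : Fin N) → A j ≡ true → count A ≡ suc (count (A ∖ ⦅ j ⦆))
count-remove A j a =
  trans (count-∩-∖ A ⦅ j ⦆) (cong (ℕ._+ count (A ∖ ⦅ j ⦆)) (count-single (A ∩ ⦅ j ⦆) j A∩j-j A∩j-others))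
  where
  A∩j-j : A j ∧ ⦅ j ⦆ j ≡ true
  A∩j-j rewrite a | ⦅⦆-self j = refl
  A∩j-others : ∀ i → i ≢ j → A i ∧ ⦅ j ⦆ i ≡ false
  A∩j-others i i≢j rewrite ⦅⦆-other i≢j = BoolP.∧-zeroʳ (A i)

count-strict : ∀ {N} {A B : Sel N} → B ⊆ A → (j : Fin N) → A j ≡ true → B j ≡ false → count B ℕ.< count A
count-strict {A = A} {B} B⊆A j a b rewrite count-⊆ B⊆A =
  ℕP.≤-trans (ℕP.≤-reflexive (ℕP.+-comm 1 (count B)))
    (ℕP.+-monoʳ-≤ (count B) (count-member (A ∖ B) j (cong₂ (λ x y → x ∧ not y) a b)))

𝟙 : Bool → ℤ
𝟙 true  = + 1
𝟙 false = + 0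

𝟙-nonneg : ∀ b → + 0 ≤ 𝟙 b
𝟙-nonneg true  = +≤+ ℕ.z≤n
𝟙-nonneg false = +≤+ ℕ.z≤n

∑-𝟙 : ∀ {N} (A : Sel N) (c : ℤ) → ∑ (λ i → 𝟙 (A i) * c) ≡ + count A * c
∑-𝟙 {zero}  A c = refl
∑-𝟙 {suc N} A c rewrite ∑-𝟙 (λ i → A (suc i)) c with A zero
... | true  = trans (cong (_+ (+ m * c)) (ℤP.*-identityˡ c))
                (trans (sym (ℤP.suc-* (+ m) c)) (cong (_* c) (sym (ℤP.pos-+ 1 m))))
  where m = count (λ i → A (suc i))
... | false = ℤP.+-identityˡ (+ count (λ i → A (suc i)) * c)

∑-⊆ : ∀ {N} {A B : Sel N} → B ⊆ A → (v : Fin N → ℤ) →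
  ∑ (λ i → 𝟙 (A i) * v i) ≡ ∑ (λ i → 𝟙 (B i) * v i) + ∑ (λ i → 𝟙 ((A ∖ B) i) * v i)
∑-⊆ {A = A} {B} B⊆A v =
  trans (∑-cong termwise) (∑-+ (λ i → 𝟙 (B i) * v i) (λ i → 𝟙 ((A ∖ B) i) * v i))
  where
  termwise : ∀ i → 𝟙 (A i) * v i ≡ 𝟙 (B i) * v i + 𝟙 ((A ∖ B) i) * v i
  termwise i with B i in b
  ... | true  rewrite B⊆A i b = sym (ℤP.+-identityʳ _)
  ... | false with A i
  ... | true  = sym (ℤP.+-identityˡ (+ 1 * v i))
  ... | false = refl

count-split : ∀ n {k} (A : Sel (n ℕ.+ k)) → count A ≡ count (λ i → A (i ↑ˡ k)) ℕ.+ count (λ t → A (n ↑ʳ t))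
count-split zero    A = refl
count-split (suc n) A =
  trans (cong (bool→ℕ (A zero) ℕ.+_) (count-split n (λ i → A (suc i)))) (sym (ℕP.+-assoc (bool→ℕ (A zero)) _ _))

∑-lin : ∀ {N} (b a : ℤ) (f g : Fin N → ℤ) → ∑ (λ i → b * f i + a * g i) ≡ b * ∑ f + a * ∑ g
∑-lin b a f g = trans (∑-+ (λ i → b * f i) (λ i → a * g i)) (cong₂ _+_ (∑-*ˡ b f) (∑-*ˡ a g))

∑-⦅⦆ : ∀ {N} (j : Fin N) (v : Fin N → ℤ) → ∑ (λ i → 𝟙 (⦅ j ⦆ i) * v i) ≡ v j
∑-⦅⦆ j v = trans (∑-single _ j (λ i i≢j → cong (λ b → 𝟙 b * v i) (⦅⦆-other i≢j)))
                 (trans (cong (λ b → 𝟙 b * v j) (⦅⦆-self j)) (ℤP.*-identityˡ (v j)))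

∑-*ʳ : ∀ {N} (f : Fin N → ℤ) (c : ℤ) → ∑ (λ i → f i * c) ≡ ∑ f * c
∑-*ʳ f c = trans (∑-cong (λ i → ℤP.*-comm (f i) c)) (trans (∑-*ˡ c f) (ℤP.*-comm c (∑ f)))

⟨_,_⟩ : ∀ {N} → (Fin N → ℤ) → (Fin N → ℤ) → ℤ
⟨ y , v ⟩ = ∑ (λ i → y i * v i)

record KernelVector {N e : ℕ} (F : Sel N) (C : Fin e → Fin N → ℤ) : Set where
  field
    vec        : Fin N → ℤ
    supported  : ∀ i → F i ≡ false → vec i ≡ + 0
    orthogonal : ∀ r → ⟨ vec , C r ⟩ ≡ + 0
    nonzero    : ∃ λ i → vec i ≢ + 0

-- Gaussian elimination, pivot step: if the first row a = C 0 has a nonzero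
-- entry a j at some j ∈ F, a kernel vector y' of the eliminated system
--   C' r i = a j · C (r+1) i − a i · C (r+1) j   on F ∖ {j}
-- yields the kernel vector  y = a j · y' − ⟨ y' , a ⟩ · e_j  of C on F.
module Elimination {N e : ℕ} (F : Sel N) (C : Fin (suc e) → Fin N → ℤ) (j : Fin N) where
  a = C zero

  eliminated : Fin e → Fin N → ℤ
  eliminated r i = a j * C (suc r) i - a i * C (suc r) j

  module Lift (Fj : F j ≡ true) (aj≢0 : a j ≢ + 0) (K' : KernelVector (F ∖ ⦅ j ⦆) eliminated) where
    open KernelVector K' renaming (vec to y'; supported to supported'; orthogonal to orthogonal'; nonzero to nonzero')
    S = ⟨ y' , a ⟩
    y : Fin N → ℤ
    y i = a j * y' i + 𝟙 (⦅ j ⦆ i) * (- S)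

    ⟨y,-⟩ : ∀ G → ⟨ y , G ⟩ ≡ a j * ⟨ y' , G ⟩ + (- S) * G j
    ⟨y,-⟩ G = begin
        ⟨ y , G ⟩
      ≡⟨ ∑-cong (λ i → distrib (a j) (y' i) (𝟙 (⦅ j ⦆ i)) (- S) (G i)) ⟩
        ∑ (λ i → a j * (y' i * G i) + (- S) * (𝟙 (⦅ j ⦆ i) * G i))
      ≡⟨ ∑-lin (a j) (- S) (λ i → y' i * G i) (λ i → 𝟙 (⦅ j ⦆ i) * G i) ⟩
        a j * ⟨ y' , G ⟩ + (- S) * ∑ (λ i → 𝟙 (⦅ j ⦆ i) * G i)
      ≡⟨ cong (λ t → a j * ⟨ y' , G ⟩ + (- S) * t) (∑-⦅⦆ j G) ⟩
        a j * ⟨ y' , G ⟩ + (- S) * G j ∎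
      where
      open ≡-Reasoning
      distrib : ∀ x w b s g → (x * w + b * s) * g ≡ x * (w * g) + s * (b * g)
      distrib = solve-∀

    ⟨y',C'⟩ : ∀ r → ⟨ y' , eliminated r ⟩ ≡ ⟨ y , C (suc r) ⟩
    ⟨y',C'⟩ r = begin
        ∑ (λ i → y' i * (a j * C (suc r) i - a i * C (suc r) j))
      ≡⟨ ∑-cong (λ i → expand (y' i) (a j) (C (suc r) i) (a i) (C (suc r) j)) ⟩
        ∑ (λ i → a j * (y' i * C (suc r) i) + (- C (suc r) j) * (y' i * a i))
      ≡⟨ ∑-lin (a j) (- C (suc r) j) (λ i → y' i * C (suc r) i) (λ i → y' i * a i) ⟩
        a j * ⟨ y' , C (suc r) ⟩ + (- C (suc r) j) * S
      ≡⟨ swap (a j * ⟨ y' , C (suc r) ⟩) S (C (suc r) j) ⟩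
        a j * ⟨ y' , C (suc r) ⟩ + (- S) * C (suc r) j
      ≡⟨ sym (⟨y,-⟩ (C (suc r))) ⟩
        ⟨ y , C (suc r) ⟩ ∎
      where
      open ≡-Reasoning
      expand : ∀ w x c z g → w * (x * c - z * g) ≡ x * (w * c) + (- g) * (w * z)
      expand = solve-∀
      swap : ∀ t s g → t + (- g) * s ≡ t + (- s) * g
      swap = solve-∀

    orthogonal : ∀ r → ⟨ y , C r ⟩ ≡ + 0
    orthogonal zero    = trans (⟨y,-⟩ a) (cancel (a j) S)
      where
      cancel : ∀ x s → x * s + (- s) * x ≡ + 0
      cancel = solve-∀
    orthogonal (suc r) = trans (sym (⟨y',C'⟩ r)) (orthogonal' r)

    supported : ∀ i → F i ≡ false → y i ≡ + 0
    supported i Fi with i FinP.≟ j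
    ... | yes refl = ⊥-elim (true≢false Fj Fi)
    ... | no i≢j rewrite supported' i (cong (λ b → b ∧ not (⦅ j ⦆ i)) Fi) =
      trans (ℤP.+-identityʳ _) (ℤP.*-zeroʳ (a j))

    nonzero : ∃ λ i → y i ≢ + 0
    nonzero with nonzero'
    ... | i , y'i≢0 = i , y≢0
      where
      F'i : (F ∖ ⦅ j ⦆) i ≡ true
      F'i = not-false ((F ∖ ⦅ j ⦆) i) (λ F'i≡false → y'i≢0 (supported' i F'i≡false))
      i≢j : i ≢ j
      i≢j refl = true≢false F'i (trans (cong (λ b → F j ∧ not b) (⦅⦆-self j)) (BoolP.∧-zeroʳ (F j)))
      y≢0 : y i ≢ + 0
      y≢0 yi≡0 rewrite ⦅⦆-other i≢j | ℤP.+-identityʳ (a j * y' i) with ℤP.i*j≡0⇒i≡0∨j≡0 (a j) yi≡0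
      ... | inj₁ aj≡0  = aj≢0 aj≡0
      ... | inj₂ y'i≡0 = y'i≢0 y'i≡0

    lifted : KernelVector F C
    lifted = record { vec = y ; supported = supported ; orthogonal = orthogonal ; nonzero = nonzero }

kernel-vector : ∀ {N} (e : ℕ) (F : Sel N) (C : Fin e → Fin N → ℤ) → e ℕ.< count F → KernelVector F C
kernel-vector zero F C e<|F| with count-witness F e<|F|
... | j , Fj = record
  { vec = λ i → 𝟙 (⦅ j ⦆ i)
  ; supported = supported
  ; orthogonal = λ ()
  ; nonzero = j , unit-nonzero
  }
  where
  supported : ∀ i → F i ≡ false → 𝟙 (⦅ j ⦆ i) ≡ + 0
  supported i Fi with i FinP.≟ j
  ... | yes refl = ⊥-elim (true≢false Fj Fi)
  ... | no _     = refl
  unit-nonzero : 𝟙 (⦅ j ⦆ j) ≢ + 0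
  unit-nonzero rewrite ⦅⦆-self j = λ ()
kernel-vector (suc e) F C e<|F| with FinP.any? (λ i → (F i Bool.≟ true) ×-dec ¬? (C zero i ℤ.≟ + 0))
... | yes (j , Fj , aj≢0) =
  Elimination.Lift.lifted F C j Fj aj≢0
    (kernel-vector e (F ∖ ⦅ j ⦆) (Elimination.eliminated F C j) (ℕP.≤-pred (subst (suc e ℕ.<_) (count-remove F j Fj) e<|F|)))
... | no first-row-vanishes-on-F = record
  { vec = vec ; supported = supported ; orthogonal = orthogonal-all ; nonzero = nonzero }
  where
  K = kernel-vector e F (λ r → C (suc r)) (ℕP.<-trans (ℕP.n<1+n e) e<|F|)
  open KernelVector K using (vec; supported; nonzero)
  vanishes : ∀ i → vec i * C zero i ≡ + 0
  vanishes i with F i in Fi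
  ... | false rewrite supported i Fi = refl
  ... | true with C zero i ℤ.≟ + 0
  ... | yes ai≡0 rewrite ai≡0 = ℤP.*-zeroʳ (vec i)
  ... | no ai≢0 = ⊥-elim (first-row-vanishes-on-F (i , Fi , ai≢0))
  orthogonal-all : ∀ r → ⟨ vec , C r ⟩ ≡ + 0
  orthogonal-all zero    = ∑-zero _ vanishes
  orthogonal-all (suc r) = KernelVector.orthogonal K r

0≤* : ∀ {x y} → + 0 ≤ x → + 0 ≤ y → + 0 ≤ x * y
0≤* {+ n} {+ m} _ _ rewrite sym (ℤP.pos-* n m) = +≤+ ℕ.z≤n

≤-+ˡ : ∀ {L R X P Q} → L ≡ X + P → R ≡ X + Q → P ≤ Q → L ≤ R
≤-+ˡ {X = X} refl refl P≤Q = ℤP.+-monoʳ-≤ X P≤Q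

+-cancelˡ-≤ : ∀ X {P Q} → X + P ≤ X + Q → P ≤ Q
+-cancelˡ-≤ X {P} {Q} h = subst₂ _≤_ (cancel X P) (cancel X Q) (ℤP.+-monoʳ-≤ (- X) h)
  where
  cancel : ∀ X P → - X + (X + P) ≡ P
  cancel = solve-∀

-- With D = D₀ + 1 and f + g ≥ 1:
--   (m + f + g)·D + f·(1 − D) = m·D + f + g·D ≥ m·D + 1.
surplus : ∀ m f g D₀ → 1 ℕ.≤ f ℕ.+ g →
  + m * + suc D₀ + + 1 ≤ + (m ℕ.+ (f ℕ.+ g)) * + suc D₀ + + f * (+ 1 - + suc D₀)
surplus m f g D₀ f+g≥1 rewrite ℤP.pos-+ m (f ℕ.+ g) | ℤP.pos-+ f g =
  ≤-+ˡ {X = + m * + suc D₀ + + 1} (sym (ℤP.+-identityʳ _)) (expand (+ m) (+ f) (+ g) (+ D₀))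
    (ℤP.+-mono-≤ f+g-1≥0 (0≤* {+ g} {+ D₀} (+≤+ ℕ.z≤n) (+≤+ ℕ.z≤n)))
  where
  expand : ∀ M F G D₀ → (M + (F + G)) * (+ 1 + D₀) + F * (+ 1 - (+ 1 + D₀)) ≡ M * (+ 1 + D₀) + + 1 + ((F + G - + 1) + G * D₀)
  expand = solve-∀
  f+g-1≥0 : + 0 ≤ + f + + g - + 1
  f+g-1≥0 rewrite sym (ℤP.pos-+ f g) = ℤP.i≤j⇒0≤j-i (+≤+ f+g≥1)

scale-cancel : ∀ {D x y} → 1 ℕ.≤ D → + D * x ≤ + D * y → x ≤ y
scale-cancel {suc D} {x} {y} _ = ℤP.*-cancelˡ-≤-pos x y (+ suc D)

-- The room a coordinate m ∈ [0, D] has when moved in direction y: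
-- up to D when y ≥ 0, down to 0 when y < 0.
room : ℤ → ℤ → ℤ → ℤ
room (+ _)    m D = D - m
room -[1+ _ ] m D = m

room-nonneg : ∀ y {m D} → + 0 ≤ m → m ≤ D → + 0 ≤ room y m D
room-nonneg (+ _)    0≤m m≤D = ℤP.i≤j⇒0≤j-i m≤D
room-nonneg -[1+ _ ] 0≤m m≤D = 0≤m

-- |y|, written so that for y ≢ 0 it is visibly positive; room y m D / ∣ y ∣⁺
-- is the largest step length along y keeping the coordinate in [0, D].
∣_∣⁺ : ℤ → ℤ
∣ y ∣⁺ = + suc (ℤ.∣ y ∣ ℕ.∸ 1)

-- A step m ↦ b·m + a·y (coordinates rescaled by b > 0) of length a/b along y
-- stays in [0, b·D] as long as a/b does not exceed the room ratio of y.
step-in-range : ∀ y {m D} a bn → + 0 ≤ m → m ≤ D → + 0 ≤ a →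
  (y ≢ + 0 → a * ∣ y ∣⁺ ≤ room y m D * + suc bn) →
  (+ 0 ≤ + suc bn * m + a * y) × (+ suc bn * m + a * y ≤ + suc bn * D)
step-in-range (+ zero) {m} {D} a bn 0≤m m≤D 0≤a _ =
  subst (+ 0 ≤_) (add0 (+ suc bn) m a) (0≤* {+ suc bn} (+≤+ ℕ.z≤n) 0≤m) ,
  subst (_≤ + suc bn * D) (add0 (+ suc bn) m a) (ℤP.*-monoˡ-≤-nonNeg (+ suc bn) m≤D)
  where
  add0 : ∀ b m a → b * m ≡ b * m + a * + 0
  add0 = solve-∀
step-in-range (+ suc n) {m} {D} a bn 0≤m m≤D 0≤a ratio =
  ℤP.+-mono-≤ (0≤* {+ suc bn} (+≤+ ℕ.z≤n) 0≤m) (0≤* {a} {+ suc n} 0≤a (+≤+ ℕ.z≤n)) ,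
  ≤-+ˡ {X = + suc bn * m} refl (split (+ suc bn) m D) (subst (a * + suc n ≤_) (ℤP.*-comm (D - m) (+ suc bn)) (ratio (λ ())))
  where
  split : ∀ b m D → b * D ≡ b * m + b * (D - m)
  split = solve-∀
step-in-range -[1+ n ] {m} {D} a bn 0≤m m≤D 0≤a ratio =
  subst (+ 0 ≤_) (sym (trans (cong (λ y → + suc bn * m + a * y) -[1+n]≡) (rearrange (+ suc bn) m a (+ n))))
    (ℤP.i≤j⇒0≤j-i (ratio (λ ()))) ,
  ℤP.≤-trans (≤-+ˡ {X = + suc bn * m} (trans (cong (λ y → + suc bn * m + a * y) -[1+n]≡) (rearrange′ (+ suc bn) m a (+ n))) (sym (ℤP.+-identityʳ _)) (ℤP.neg-mono-≤ (0≤* {a} {+ 1 + + n} 0≤a (+≤+ ℕ.z≤n))))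
             (ℤP.*-monoˡ-≤-nonNeg (+ suc bn) m≤D)
  where
  -[1+n]≡ : -[1+ n ] ≡ - (+ 1 + + n)
  -[1+n]≡ = cong -_ (ℤP.pos-+ 1 n)
  rearrange : ∀ b m a n → b * m + a * (- (+ 1 + n)) ≡ m * b - a * (+ 1 + n)
  rearrange = solve-∀
  rearrange′ : ∀ b m a n → b * m + a * (- (+ 1 + n)) ≡ b * m + - (a * (+ 1 + n))
  rearrange′ = solve-∀

step-exhausts-room : ∀ y m D → y ≢ + 0 →
  (∣ y ∣⁺ * m + room y m D * y ≡ + 0) ⊎ (∣ y ∣⁺ * m + room y m D * y ≡ ∣ y ∣⁺ * D)
step-exhausts-room (+ zero)  m D y≢0 = ⊥-elim (y≢0 refl)
step-exhausts-room (+ suc n) m D _   = inj₂ (reaches-top (+ suc n) m D)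
  where
  reaches-top : ∀ b m D → b * m + (D - m) * b ≡ b * D
  reaches-top = solve-∀
step-exhausts-room -[1+ n ]  m D _   = inj₁ (trans (cong (λ y → ∣ -[1+ n ] ∣⁺ * m + m * y) -[1+n]≡) (reaches-bottom (+ n) m))
  where
  -[1+n]≡ : -[1+ n ] ≡ - (+ 1 + + n)
  -[1+n]≡ = cong -_ (ℤP.pos-+ 1 n)
  reaches-bottom : ∀ n m → (+ 1 + n) * m + m * (- (+ 1 + n)) ≡ + 0
  reaches-bottom = solve-∀

argmin : ∀ {N} (P : Fin N → Set) → (∀ i → Dec (P i)) → (key : Fin N → ℚᵘ) → ∃ P →
  Σ[ i ∈ Fin N ] (P i × (∀ j → P j → key i ≤ℚ key j))
argmin {suc N} P P? key (j , Pj) with FinP.any? (λ i → P? (suc i))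
argmin {suc N} P P? key (j , Pj) | yes ∃P∘suc with argmin (λ i → P (suc i)) (λ i → P? (suc i)) (λ i → key (suc i)) ∃P∘suc
... | i , Pi , min with P? zero
... | no ¬P0 = suc i , Pi , λ { zero P0 → ⊥-elim (¬P0 P0) ; (suc k) Pk → min k Pk }
... | yes P0 with ℚP.≤-total (key zero) (key (suc i))
... | inj₁ 0≤i = zero , P0 , λ { zero _ → ℚP.≤-refl ; (suc k) Pk → ℚP.≤-trans 0≤i (min k Pk) }
... | inj₂ i≤0 = suc i , Pi , λ { zero _ → i≤0 ; (suc k) Pk → min k Pk }
argmin {suc N} P P? key (zero , P0) | no ¬∃P∘suc =
  zero , P0 , λ { zero _ → ℚP.≤-refl ; (suc k) Pk → ⊥-elim (¬∃P∘suc (k , Pk)) }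
argmin {suc N} P P? key (suc j , Pj) | no ¬∃P∘suc = ⊥-elim (¬∃P∘suc (j , Pj))

-- Rational points x = μ / D of the polytope
--   P(A, m) = { x ∈ [0,1]^N : x = 0 off A, ∑ xᵢ uᵢ = 0, ∑ xᵢ = m }
-- attached to vectors u₀, …, u_{N-1} ∈ ℤ^d and a subset A.
module Polytope {N d : ℕ} (u : Fin N → Fin d → ℤ) where

  record Point (A : Sel N) (m : ℕ) : Set where
    constructor point
    field
      μ         : Fin N → ℤ
      D         : ℕ
      D-pos     : 1 ℕ.≤ D
      supported : ∀ i → A i ≡ false → μ i ≡ + 0
      nonneg    : ∀ i → + 0 ≤ μ i
      bounded   : ∀ i → μ i ≤ + D
      balanced  : ∀ c → ∑ (λ i → μ i * u i c) ≡ + 0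
      total     : ∑ μ ≡ + m * + D

  Fractional : ∀ {A m} → Point A m → Sel N
  Fractional {A} V = A ∖ (λ i → does (μ i ℤ.≟ + D))
    where open Point V

  PointWithZero : Sel N → ℕ → Set
  PointWithZero A m = Σ[ V ∈ Point A m ] ∃ λ i → A i ≡ true × Point.μ V i ≡ + 0

  -- If |A| = m + d + 1 and all coordinates on A are positive, more than d + 1
  -- of them are fractional: a point with f fractional coordinates satisfies
  --   m·D = ∑ μ ≥ |A|·D + f·(1 − D) = m·D + (d + 1 − f)·D + f,
  -- which exceeds m·D when f ≤ d + 1.
  many-fractional : ∀ {A m} (V : Point A m) → count A ≡ m ℕ.+ suc d →
    (∀ i → A i ≡ true → Point.μ V i ≢ + 0) → suc d ℕ.< count (Fractional V)
  many-fractional {A} {m} V@(point μ (suc D₀) _ _ nonneg _ _ total) |A| positive =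
    ℕP.≰⇒> λ f≤d+1 → excess (ℕP.m≤n⇒∃[o]m+o≡n f≤d+1)
    where
    D = suc D₀
    F = Fractional V
    f = count F

    lower-bound : ∀ i → 𝟙 (A i) * + D + 𝟙 (F i) * (+ 1 - + D) ≤ μ i
    lower-bound i with A i in Ai
    ... | false = nonneg i
    ... | true with μ i ℤ.≟ + D
    ... | yes μi≡D = ℤP.≤-reflexive (trans (at-top (+ D) (+ 1 - + D)) (sym μi≡D))
      where
      at-top : ∀ D X → + 1 * D + + 0 * X ≡ D
      at-top = solve-∀
    ... | no _ = subst (_≤ μ i) (sym (at-least-one (+ D))) (ℤP.≤-trans (+≤+ (ℕ.s≤s ℕ.z≤n)) μi≥1)
      where
      at-least-one : ∀ D → + 1 * D + + 1 * (+ 1 - D) ≡ + 1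
      at-least-one = solve-∀
      μi≥1 : + 1 ≤ μ i
      μi≥1 with μ i | nonneg i | positive i Ai
      ... | + zero  | _ | μi≢0 = ⊥-elim (μi≢0 refl)
      ... | + suc _ | _ | _    = +≤+ (ℕ.s≤s ℕ.z≤n)

    sum-bound : + (m ℕ.+ suc d) * + D + + f * (+ 1 - + D) ≤ + m * + D
    sum-bound = begin
        + (m ℕ.+ suc d) * + D + + f * (+ 1 - + D)
      ≡⟨ cong (λ k → + k * + D + + f * (+ 1 - + D)) (sym |A|) ⟩
        + count A * + D + + f * (+ 1 - + D)
      ≡⟨ sym (cong₂ _+_ (∑-𝟙 A (+ D)) (∑-𝟙 F (+ 1 - + D))) ⟩
        ∑ (λ i → 𝟙 (A i) * + D) + ∑ (λ i → 𝟙 (F i) * (+ 1 - + D))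
      ≡⟨ sym (∑-+ (λ i → 𝟙 (A i) * + D) (λ i → 𝟙 (F i) * (+ 1 - + D))) ⟩
        ∑ (λ i → 𝟙 (A i) * + D + 𝟙 (F i) * (+ 1 - + D))
      ≤⟨ ∑-mono lower-bound ⟩
        ∑ μ
      ≡⟨ total ⟩
        + m * + D ∎
      where open ℤP.≤-Reasoning

    excess : ∃ (λ g → f ℕ.+ g ≡ suc d) → ⊥
    excess (g , f+g≡d+1) with +-cancelˡ-≤ (+ m * + D) {+ 1} {+ 0} (begin
        + m * + D + + 1
      ≤⟨ surplus m f g D₀ (subst (1 ℕ.≤_) (sym f+g≡d+1) (ℕ.s≤s ℕ.z≤n)) ⟩
        + (m ℕ.+ (f ℕ.+ g)) * + D + + f * (+ 1 - + D)
      ≡⟨ cong (λ t → + (m ℕ.+ t) * + D + + f * (+ 1 - + D)) f+g≡d+1 ⟩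
        + (m ℕ.+ suc d) * + D + + f * (+ 1 - + D)
      ≤⟨ sum-bound ⟩
        + m * + D
      ≡⟨ sym (ℤP.+-identityʳ _) ⟩
        + m * + D + + 0 ∎)
      where open ℤP.≤-Reasoning
    ... | +≤+ ()

  -- The linear constraints defining the affine hull of P(A, m) (up to the
  -- right-hand side): the coordinate sum and the d coordinates of ∑ xᵢ uᵢ.
  constraint : Fin (suc d) → Fin N → ℤ
  constraint zero    i = + 1
  constraint (suc c) i = u i c

  -- A direction y that moves only fractional coordinates
  -- and preserves all constraints is followed from V by the largest step
  -- a/b keeping every coordinate in [0,1]: with s minimising room/|y|,
  --   a = room of s,  b = |y s|,  μ' = b·μ + a·y,  D' = b·D.
  module PivotStep {A : Sel N} {m : ℕ} (V : Point A m) (K : KernelVector (Fractional V) constraint) where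
    open Point V
    open KernelVector K renaming (vec to y; supported to y-off-fractional)

    ratio : Fin N → ℚᵘ
    ratio i = mkℚᵘ (room (y i) (μ i) (+ D)) (ℤ.∣ y i ∣ ℕ.∸ 1)

    minimiser = argmin (λ i → y i ≢ + 0) (λ i → ¬? (y i ℤ.≟ + 0)) ratio nonzero
    s = proj₁ minimiser
    ys≢0 : y s ≢ + 0
    ys≢0 = proj₁ (proj₂ minimiser)
    bn = ℤ.∣ y s ∣ ℕ.∸ 1
    b = ∣ y s ∣⁺
    a = room (y s) (μ s) (+ D)

    μ' : Fin N → ℤ
    μ' i = b * μ i + a * y i
    D' = suc bn ℕ.* D
    +D' : + D' ≡ b * + D
    +D' = ℤP.pos-* (suc bn) D

    in-range : ∀ j → (+ 0 ≤ μ' j) × (μ' j ≤ b * + D)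
    in-range j = step-in-range (y j) a bn (nonneg j) (bounded j) (room-nonneg (y s) (nonneg s) (bounded s))
      (λ yj≢0 → unfold (proj₂ (proj₂ minimiser) j yj≢0))
      where
      unfold : ratio s ≤ℚ ratio j → a * ∣ y j ∣⁺ ≤ room (y j) (μ j) (+ D) * b
      unfold (*≤* ≤) = ≤

    ∑y≡0 : ∑ y ≡ + 0
    ∑y≡0 = trans (∑-cong (λ i → sym (ℤP.*-identityʳ (y i)))) (orthogonal zero)

    supported' : ∀ i → A i ≡ false → μ' i ≡ + 0
    supported' i Ai rewrite y-off-fractional i (∖-false (inj₁ Ai)) | supported i Ai = vanish b a
      where
      vanish : ∀ b a → b * + 0 + a * + 0 ≡ + 0
      vanish = solve-∀

    balanced' : ∀ c → ∑ (λ i → μ' i * u i c) ≡ + 0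
    balanced' c = begin
        ∑ (λ i → μ' i * u i c)
      ≡⟨ ∑-cong (λ i → distrib b (μ i) a (y i) (u i c)) ⟩
        ∑ (λ i → b * (μ i * u i c) + a * (y i * u i c))
      ≡⟨ ∑-lin b a (λ i → μ i * u i c) (λ i → y i * u i c) ⟩
        b * ∑ (λ i → μ i * u i c) + a * ∑ (λ i → y i * u i c)
      ≡⟨ cong₂ (λ p q → b * p + a * q) (balanced c) (orthogonal (suc c)) ⟩
        b * + 0 + a * + 0
      ≡⟨ vanish b a ⟩
        + 0 ∎
      where
      open ≡-Reasoning
      distrib : ∀ b m a y u → (b * m + a * y) * u ≡ b * (m * u) + a * (y * u)
      distrib = solve-∀
      vanish : ∀ b a → b * + 0 + a * + 0 ≡ + 0
      vanish = solve-∀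

    total' : ∑ μ' ≡ + m * + D'
    total' = begin
        ∑ μ'
      ≡⟨ ∑-lin b a μ y ⟩
        b * ∑ μ + a * ∑ y
      ≡⟨ cong₂ (λ p q → b * p + a * q) total ∑y≡0 ⟩
        b * (+ m * + D) + a * + 0
      ≡⟨ rescale b (+ m) (+ D) a ⟩
        + m * (b * + D)
      ≡⟨ cong (+ m *_) (sym +D') ⟩
        + m * + D' ∎
      where
      open ≡-Reasoning
      rescale : ∀ b m D a → b * (m * D) + a * + 0 ≡ m * (b * D)
      rescale = solve-∀

    next : Point A m
    next = point μ' D' (ℕP.≤-trans D-pos (ℕP.m≤n*m D (suc bn))) supported'
      (λ j → proj₁ (in-range j)) (λ j → subst (μ' j ≤_) (sym +D') (proj₂ (in-range j))) balanced' total'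

    -- Coordinates at the top stay at the top, as y vanishes there.
    fractional-shrinks : Fractional next ⊆ Fractional V
    fractional-shrinks i Fi' = not-false (Fractional V i) still-top
      where
      still-top : Fractional V i ≡ false → ⊥
      still-top Fi with ∖-false⁻¹ (A i) _ Fi
      ... | inj₁ Ai   = true≢false Fi' (∖-false (inj₁ Ai))
      ... | inj₂ μi≡D = true≢false Fi' (∖-false (inj₂ (dec-true (μ' i ℤ.≟ + D') μ'i≡D')))
        where
        μ'i≡D' : μ' i ≡ + D'
        μ'i≡D' = begin
            b * μ i + a * y i
          ≡⟨ cong₂ (λ p q → b * p + a * q) (at-top μi≡D) (y-off-fractional i Fi) ⟩
            b * + D + a * + 0
          ≡⟨ drop (b * + D) a ⟩
            b * + D
          ≡⟨ sym +D' ⟩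
            + D' ∎
          where
          open ≡-Reasoning
          at-top : does (μ i ℤ.≟ + D) ≡ true → μ i ≡ + D
          at-top e with μ i ℤ.≟ + D
          ... | yes p = p
          drop : ∀ x a → x + a * + 0 ≡ x
          drop = solve-∀

    s-fractional : Fractional V s ≡ true
    s-fractional = not-false (Fractional V s) (λ Fs → ys≢0 (y-off-fractional s Fs))

    s-exhausted : (μ' s ≡ + 0) ⊎ (Fractional next s ≡ false)
    s-exhausted with step-exhausts-room (y s) (μ s) (+ D) ys≢0
    ... | inj₁ bottom = inj₁ bottom
    ... | inj₂ top    = inj₂ (∖-false (inj₂ (dec-true (μ' s ℤ.≟ + D') (trans top (sym +D')))))

  -- A pivoting step from a point with more than d + 1 fractional coordinates
  -- (so that the d + 1 constraints have a kernel direction on them) either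
  -- produces a vanishing coordinate on A or fixes one more coordinate at the top.
  pivot : ∀ {A m} (V : Point A m) → suc d ℕ.< count (Fractional V) →
    PointWithZero A m ⊎ Σ[ V' ∈ Point A m ] count (Fractional V') ℕ.< count (Fractional V)
  pivot {A} V many = result
    where
    open PivotStep V (kernel-vector (suc d) (Fractional V) constraint many)
    result : PointWithZero A _ ⊎ Σ[ V' ∈ Point A _ ] count (Fractional V') ℕ.< count (Fractional V)
    result with s-exhausted
    ... | inj₁ μ's≡0 = inj₁ (next , s , ∖-⊆ A (λ i → does (Point.μ V i ℤ.≟ + Point.D V)) s s-fractional , μ's≡0)
    ... | inj₂ s-top = inj₂ (next , count-strict fractional-shrinks s s-fractional s-top)

  -- Pivoting until a coordinate on A vanishes, by induction on the number of
  -- fractional coordinates; when |A| = m + d + 1 there are more than d + 1 of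
  -- them as long as no coordinate on A vanishes.
  find-zero : ∀ {A m} → count A ≡ m ℕ.+ suc d → (fuel : ℕ) (V : Point A m) →
    count (Fractional V) ℕ.≤ fuel → PointWithZero A m
  find-zero {A} |A| fuel V fuel-bound
    with FinP.any? (λ i → (A i Bool.≟ true) ×-dec (Point.μ V i ℤ.≟ + 0))
  ... | yes (i , Ai , μi≡0) = V , i , Ai , μi≡0
  ... | no no-zero with many-fractional V |A| (λ i Ai μi≡0 → no-zero (i , Ai , μi≡0)) | fuel
  ...   | many | zero     = ⊥-elim (ℕP.<⇒≱ (ℕP.<-trans ℕP.0<1+n many) fuel-bound)
  ...   | many | suc fuel′ with pivot V many
  ...     | inj₁ found       = found
  ...     | inj₂ (V' , less) = find-zero |A| fuel′ V' (ℕP.≤-pred (ℕP.≤-trans less fuel-bound))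

  vertex : ∀ {A m} → count A ≡ m ℕ.+ suc d → Point A m → PointWithZero A m
  vertex |A| V = find-zero |A| N V (count-≤ (Fractional V))

Bounded : ℕ → ℤ → Set
Bounded R x = - (+ R) ≤ x × x ≤ + R

module SteinitzChain {N d : ℕ} (u : Fin N → Fin d → ℤ) (r : ℕ) (u-bounded : ∀ i c → Bounded r (u i c)) where
  open Polytope u

  subsetSum : Sel N → Fin d → ℤ
  subsetSum A c = ∑ (λ i → 𝟙 (A i) * u i c)

  weighted-bound : (w : Fin N → ℤ) → (∀ i → + 0 ≤ w i) → ∀ c →
    (- (∑ w * + r) ≤ ∑ (λ i → w i * u i c)) × (∑ (λ i → w i * u i c) ≤ ∑ w * + r)
  weighted-bound w w≥0 c =
    subst (_≤ ∑ (λ i → w i * u i c)) (trans (∑-*ʳ w (- + r)) (sym (ℤP.neg-distribʳ-* (∑ w) (+ r))))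
      (∑-mono (λ i → ℤP.*-monoˡ-≤-nonNeg (w i) {{nonNeg (w≥0 i)}} (proj₁ (u-bounded i c)))) ,
    subst (∑ (λ i → w i * u i c) ≤_) (∑-*ʳ w (+ r))
      (∑-mono (λ i → ℤP.*-monoˡ-≤-nonNeg (w i) {{nonNeg (w≥0 i)}} (proj₂ (u-bounded i c))))
    where
    nonNeg : ∀ {x} → + 0 ≤ x → ℤ.NonNegative x
    nonNeg {+ n} _ = _

  small-subset-bounded : (A : Sel N) → count A ℕ.≤ d → ∀ c → Bounded (r ℕ.* d) (subsetSum A c)
  small-subset-bounded A |A|≤d c =
    ℤP.≤-trans (ℤP.neg-mono-≤ W·r≤rd) (proj₁ wb) , ℤP.≤-trans (proj₂ wb) W·r≤rd
    where
    wb = weighted-bound (λ i → 𝟙 (A i)) (λ i → 𝟙-nonneg (A i)) c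
    W·r≤rd : ∑ (λ i → 𝟙 (A i)) * + r ≤ + (r ℕ.* d)
    W·r≤rd rewrite trans (∑-cong (λ i → sym (ℤP.*-identityʳ (𝟙 (A i))))) (trans (∑-𝟙 A (+ 1)) (ℤP.*-identityʳ (+ count A)))
                 | sym (ℤP.pos-* (count A) r) | ℕP.*-comm r d = +≤+ (ℕP.*-monoˡ-≤ r |A|≤d)

  -- The complementary weights D·𝟙_A − μ of a point μ/D of P(A, |A| − d):
  -- they are nonnegative, have total d·D, and ∑ (D·𝟙_A − μ)ᵢ uᵢ = D·∑_{i∈A} uᵢ.
  module Complement (A : Sel N) (d≤|A| : d ℕ.≤ count A) (V : Point A (count A ℕ.∸ d)) where
    open Point V

    w : Fin N → ℤ
    w i = 𝟙 (A i) * + D - μ i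

    w≥0 : ∀ i → + 0 ≤ w i
    w≥0 i with A i in Ai
    ... | false rewrite supported i Ai = +≤+ ℕ.z≤n
    ... | true  = ℤP.i≤j⇒0≤j-i (subst (μ i ≤_) (sym (ℤP.*-identityˡ (+ D))) (bounded i))

    weighted-sum : ∀ c → ∑ (λ i → w i * u i c) ≡ + D * subsetSum A c
    weighted-sum c = begin
        ∑ (λ i → w i * u i c)
      ≡⟨ ∑-cong (λ i → expand (𝟙 (A i)) (+ D) (μ i) (u i c)) ⟩
        ∑ (λ i → + D * (𝟙 (A i) * u i c) + - + 1 * (μ i * u i c))
      ≡⟨ ∑-lin (+ D) (- + 1) (λ i → 𝟙 (A i) * u i c) (λ i → μ i * u i c) ⟩
        + D * subsetSum A c + - + 1 * ∑ (λ i → μ i * u i c)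
      ≡⟨ cong (λ t → + D * subsetSum A c + - + 1 * t) (balanced c) ⟩
        + D * subsetSum A c + - + 1 * + 0
      ≡⟨ drop (+ D * subsetSum A c) ⟩
        + D * subsetSum A c ∎
      where
      open ≡-Reasoning
      expand : ∀ a D m x → (a * D - m) * x ≡ D * (a * x) + - + 1 * (m * x)
      expand = solve-∀
      drop : ∀ x → x + - + 1 * + 0 ≡ x
      drop = solve-∀

    total-weight : ∑ w * + r ≡ + D * + (r ℕ.* d)
    total-weight = begin
        ∑ w * + r
      ≡⟨ cong (_* + r) (trans (∑-cong (λ i → as-combination (𝟙 (A i) * + D) (μ i))) (∑-lin (+ 1) (- + 1) (λ i → 𝟙 (A i) * + D) μ)) ⟩
        (+ 1 * ∑ (λ i → 𝟙 (A i) * + D) + - + 1 * ∑ μ) * + r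
      ≡⟨ cong₂ (λ p q → (+ 1 * p + - + 1 * q) * + r) (∑-𝟙 A (+ D)) total ⟩
        (+ 1 * (+ K * + D) + - + 1 * (+ (K ℕ.∸ d) * + D)) * + r
      ≡⟨ cong (λ k → (+ 1 * (+ k * + D) + - + 1 * (+ (K ℕ.∸ d) * + D)) * + r) (sym (ℕP.m∸n+n≡m d≤|A|)) ⟩
        (+ 1 * (+ ((K ℕ.∸ d) ℕ.+ d) * + D) + - + 1 * (+ (K ℕ.∸ d) * + D)) * + r
      ≡⟨ cong (λ k → (+ 1 * (k * + D) + - + 1 * (+ (K ℕ.∸ d) * + D)) * + r) (ℤP.pos-+ (K ℕ.∸ d) d) ⟩
        (+ 1 * ((+ (K ℕ.∸ d) + + d) * + D) + - + 1 * (+ (K ℕ.∸ d) * + D)) * + r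
      ≡⟨ simplify (+ (K ℕ.∸ d)) (+ d) (+ D) (+ r) ⟩
        + D * (+ r * + d)
      ≡⟨ cong (+ D *_) (sym (ℤP.pos-* r d)) ⟩
        + D * + (r ℕ.* d) ∎
      where
      open ≡-Reasoning
      K = count A
      as-combination : ∀ x m → x - m ≡ + 1 * x + - + 1 * m
      as-combination = solve-∀
      simplify : ∀ E d D r → (+ 1 * ((E + d) * D) + - + 1 * (E * D)) * r ≡ D * (r * d)
      simplify = solve-∀

  -- If P(A, |A| − d) contains x, then ∑_{i∈A} uᵢ = ∑ (1 − xᵢ) uᵢ is a
  -- combination with weights in [0,1] of total weight d, so lies in [-rd, rd]^d.
  polytope-bounded : (A : Sel N) → d ℕ.≤ count A → Point A (count A ℕ.∸ d) → ∀ c → Bounded (r ℕ.* d) (subsetSum A c)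
  polytope-bounded A d≤|A| V c =
    scale-cancel (Point.D-pos V) (subst₂ _≤_ (trans (cong -_ total-weight) (ℤP.neg-distribʳ-* (+ Point.D V) _)) (weighted-sum c) (proj₁ wb)) ,
    scale-cancel (Point.D-pos V) (subst₂ _≤_ (weighted-sum c) total-weight (proj₂ wb))
    where
    open Complement A d≤|A| V
    wb = weighted-bound w w≥0 c

  rescale-point : ∀ {A} e → Point A (suc e) → Point A e
  rescale-point e (point μ D D-pos supported nonneg bounded balanced total) =
    point (λ i → + e * μ i) (suc e ℕ.* D) (ℕP.≤-trans D-pos (ℕP.m≤n*m D (suc e)))
      (λ i Ai → trans (cong (+ e *_) (supported i Ai)) (ℤP.*-zeroʳ (+ e)))
      (λ i → 0≤* {+ e} (+≤+ ℕ.z≤n) (nonneg i))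
      (λ i → ℤP.≤-trans (ℤP.*-monoˡ-≤-nonNeg (+ e) (bounded i))
                        (subst (+ e * + D ≤_) (sym +D°) (ℤP.*-monoʳ-≤-nonNeg (+ D) (+≤+ (ℕP.n≤1+n e)))))
      (λ c → trans (∑-cong (λ i → ℤP.*-assoc (+ e) (μ i) (u i c)))
               (trans (∑-*ˡ (+ e) (λ i → μ i * u i c)) (trans (cong (+ e *_) (balanced c)) (ℤP.*-zeroʳ (+ e)))))
      (trans (∑-*ˡ (+ e) μ) (trans (cong (+ e *_) total) (cong (+ e *_) (sym +D°))))
    where
    +D° : + (suc e ℕ.* D) ≡ + suc e * + D
    +D° = ℤP.pos-* (suc e) D

  restrict-point : ∀ {A m} (V : Point A m) (j : Fin N) → Point.μ V j ≡ + 0 → Point (A ∖ ⦅ j ⦆) m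
  restrict-point {A} (point μ D D-pos supported nonneg bounded balanced total) j μj≡0 =
    point μ D D-pos supported′ nonneg bounded balanced total
    where
    supported′ : ∀ i → (A ∖ ⦅ j ⦆) i ≡ false → μ i ≡ + 0
    supported′ i Ai′ with ∖-false⁻¹ (A i) (⦅ j ⦆ i) Ai′
    ... | inj₁ Ai  = supported i Ai
    ... | inj₂ i≡j = subst (λ k → μ k ≡ + 0) (sym (⦅⦆-sound i≡j)) μj≡0

  Admissible : Sel N → Set
  Admissible A = d ℕ.≤ count A → Point A (count A ℕ.∸ d)

  admissible-bounded : (A : Sel N) → Admissible A → ∀ c → Bounded (r ℕ.* d) (subsetSum A c)
  admissible-bounded A adm c with d ℕ.≤? count A
  ... | yes d≤|A| = polytope-bounded A d≤|A| (adm d≤|A|) c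
  ... | no  d≰|A| = small-subset-bounded A (ℕP.<⇒≤ (ℕP.≰⇒> d≰|A|)) c

  -- For |A| = k + 1 > d, rescale a
  -- point of P(A, k + 1 − d) into P(A, k − d) and move it to a vertex, which
  -- has a zero coordinate j ∈ A since |A| = (k − d) + d + 1.
  remove-element : (A : Sel N) (k : ℕ) → count A ≡ suc k → Admissible A →
    Σ[ j ∈ Fin N ] (A j ≡ true × Admissible (A ∖ ⦅ j ⦆))
  remove-element A k |A| adm with d ℕ.≤? k
  ... | no d≰k = j , Aj , λ d≤|A∖j| → ⊥-elim (d≰k (subst (d ℕ.≤_) |A∖j|≡k d≤|A∖j|))
    where
    witness = count-witness A (subst (0 ℕ.<_) (sym |A|) ℕP.0<1+n)
    j = proj₁ witness
    Aj = proj₂ witness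
    |A∖j|≡k = ℕP.suc-injective (trans (sym (count-remove A j Aj)) |A|)
  ... | yes d≤k with vertex |A|≡e+d+1 (rescale-point e V)
    where
    e = k ℕ.∸ d
    |A|≡e+d+1 : count A ≡ e ℕ.+ suc d
    |A|≡e+d+1 = trans |A| (trans (cong suc (sym (ℕP.m∸n+n≡m d≤k))) (sym (ℕP.+-suc e d)))
    V : Point A (suc e)
    V = subst (Point A) (trans (cong (ℕ._∸ d) |A|) (ℕP.+-∸-assoc 1 d≤k))
              (adm (subst (d ℕ.≤_) (sym |A|) (ℕP.m≤n⇒m≤1+n d≤k)))
  ... | V′ , j , Aj , μj≡0 = j , Aj , λ _ → subst (λ n → Point (A ∖ ⦅ j ⦆) (n ℕ.∸ d)) (sym |A∖j|≡k) (restrict-point V′ j μj≡0)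
    where
    |A∖j|≡k = ℕP.suc-injective (trans (sym (count-remove A j Aj)) |A|)

  Stage : Set
  Stage = Σ (Sel N) Admissible

  record Shrinking (A : Sel N) : Set where
    field
      next       : Stage
      next⊆      : proj₁ next ⊆ A
      next-count : count (proj₁ next) ≡ count A ℕ.∸ 1

  shrink : ∀ (S : Stage) → Shrinking (proj₁ S)
  shrink (A , adm) = shrink-count (count A) refl
    where
    shrink-count : ∀ k → count A ≡ k → Shrinking A
    shrink-count zero    |A| = record { next = A , adm ; next⊆ = λ _ a → a ; next-count = trans |A| (cong (ℕ._∸ 1) (sym |A|)) }
    shrink-count (suc k) |A| with remove-element A k |A| adm
    ... | j , Aj , adm′ = record
      { next = A ∖ ⦅ j ⦆ , adm′
      ; next⊆ = ∖-⊆ A ⦅ j ⦆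
      ; next-count = trans (ℕP.suc-injective (trans (sym (count-remove A j Aj)) |A|)) (cong (ℕ._∸ 1) (sym |A|))
      }

  chain : Stage → ℕ → Sel N
  stage : Stage → ℕ → Stage
  chain S t = proj₁ (stage S t)
  stage S zero    = S
  stage S (suc t) = Shrinking.next (shrink (stage S t))

  chain-count : ∀ S t → count (chain S t) ≡ count (proj₁ S) ℕ.∸ t
  chain-count S zero    = refl
  chain-count S (suc t) = begin
      count (chain S (suc t))
    ≡⟨ Shrinking.next-count (shrink (stage S t)) ⟩
      count (chain S t) ℕ.∸ 1
    ≡⟨ cong (ℕ._∸ 1) (chain-count S t) ⟩
      count (proj₁ S) ℕ.∸ t ℕ.∸ 1
    ≡⟨ ℕP.∸-+-assoc (count (proj₁ S)) t 1 ⟩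
      count (proj₁ S) ℕ.∸ (t ℕ.+ 1)
    ≡⟨ cong (count (proj₁ S) ℕ.∸_) (ℕP.+-comm t 1) ⟩
      count (proj₁ S) ℕ.∸ suc t ∎
    where open ≡-Reasoning

  chain-nested : ∀ S a δ → chain S (δ ℕ.+ a) ⊆ chain S a
  chain-nested S a zero    i x = x
  chain-nested S a (suc δ) i x = chain-nested S a δ i (Shrinking.next⊆ (shrink (stage S (δ ℕ.+ a))) i x)

  chain-antitone : ∀ S {a b} → a ℕ.≤ b → chain S b ⊆ chain S a
  chain-antitone S {a} {b} a≤b = subst (λ t → chain S t ⊆ chain S a) (ℕP.m∸n+n≡m a≤b) (chain-nested S a (b ℕ.∸ a))

  chain-⊆ : ∀ S t → chain S t ⊆ proj₁ S
  chain-⊆ S t = chain-antitone S {0} {t} ℕ.z≤n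

  chain-strict : ∀ S {a b} → a ℕ.< b → b ℕ.≤ count (proj₁ S) → 0 ℕ.< count (chain S a ∖ chain S b)
  chain-strict S {a} {b} a<b b≤|A| = ℕP.n≢0⇒n>0 λ empty → ℕP.<-irrefl (begin
      count (proj₁ S) ℕ.∸ b
    ≡⟨ sym (chain-count S b) ⟩
      count (chain S b)
    ≡⟨ sym (ℕP.+-identityʳ _) ⟩
      count (chain S b) ℕ.+ 0
    ≡⟨ cong (count (chain S b) ℕ.+_) (sym empty) ⟩
      count (chain S b) ℕ.+ count (chain S a ∖ chain S b)
    ≡⟨ sym (count-⊆ (chain-antitone S (ℕP.<⇒≤ a<b))) ⟩
      count (chain S a)
    ≡⟨ chain-count S a ⟩
      count (proj₁ S) ℕ.∸ a ∎)
    (ℕP.∸-monoʳ-< a<b b≤|A|)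
    where open ≡-Reasoning

  chain-bounded : ∀ S t c → Bounded (r ℕ.* d) (subsetSum (chain S t) c)
  chain-bounded S t c = admissible-bounded (chain S t) (proj₂ (stage S t)) c

encode-bounded : (R : ℕ) (x : ℤ) → Bounded R x → Fin (suc (R ℕ.+ R))
encode-bounded R x (lower , upper) = fromℕ< {ℤ.∣ x + + R ∣} (ℕ.s≤s (ℤP.drop‿+≤+ x+R≤2R))
  where
  x+R≤2R : + ℤ.∣ x + + R ∣ ≤ + (R ℕ.+ R)
  x+R≤2R rewrite ℤP.0≤i⇒+∣i∣≡i (subst (_≤ x + + R) (ℤP.+-inverseˡ (+ R)) (ℤP.+-monoˡ-≤ (+ R) lower))
               | ℤP.pos-+ R R = ℤP.+-monoˡ-≤ (+ R) upper

encode-bounded-injective : ∀ R x y (bx : Bounded R x) (by : Bounded R y) →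
  encode-bounded R x bx ≡ encode-bounded R y by → x ≡ y
encode-bounded-injective R x y (lx , _) (ly , _) e =
  ∙-cancelʳ (+ R) x y (begin
      x + + R
    ≡⟨ sym (ℤP.0≤i⇒+∣i∣≡i (shifted-nonneg lx)) ⟩
      + ℤ.∣ x + + R ∣
    ≡⟨ cong +_ (trans (sym (FinP.toℕ-fromℕ< _)) (trans (cong toℕ e) (FinP.toℕ-fromℕ< _))) ⟩
      + ℤ.∣ y + + R ∣
    ≡⟨ ℤP.0≤i⇒+∣i∣≡i (shifted-nonneg ly) ⟩
      y + + R ∎)
  where
  open ≡-Reasoning
  shifted-nonneg : ∀ {z} → - (+ R) ≤ z → + 0 ≤ z + + R
  shifted-nonneg {z} l = subst (_≤ z + + R) (ℤP.+-inverseˡ (+ R)) (ℤP.+-monoˡ-≤ (+ R) l)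

encode : (R : ℕ) {d : ℕ} (v : Fin d → ℤ) → (∀ c → Bounded R (v c)) → Fin (suc (R ℕ.+ R) ℕ.^ d)
encode R {zero}  v b = zero
encode R {suc d} v b = combine (encode-bounded R (v zero) (b zero)) (encode R (λ c → v (suc c)) (λ c → b (suc c)))

encode-injective : ∀ R {d} (v w : Fin d → ℤ) (bv : ∀ c → Bounded R (v c)) (bw : ∀ c → Bounded R (w c)) →
  encode R v bv ≡ encode R w bw → ∀ c → v c ≡ w c
encode-injective R {suc d} v w bv bw e = λ where
    zero    → encode-bounded-injective R (v zero) (w zero) (bv zero) (bw zero) (proj₁ heads-and-tails)
    (suc c) → encode-injective R (λ c → v (suc c)) (λ c → w (suc c)) (λ c → bv (suc c)) (λ c → bw (suc c))
                (proj₂ heads-and-tails) c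
  where
  heads-and-tails = FinP.combine-injective
    (encode-bounded R (v zero) (bv zero)) (encode R (λ c → v (suc c)) (λ c → bv (suc c)))
    (encode-bounded R (w zero) (bw zero)) (encode R (λ c → w (suc c)) (λ c → bw (suc c))) e

module ZeroSum {N d : ℕ} (u : Fin N → Fin d → ℤ) (r : ℕ) (u-bounded : ∀ i c → Bounded r (u i c)) (special : Sel N) where
  open Polytope u
  open SteinitzChain u r u-bounded

  M : ℕ
  M = suc (r ℕ.* d ℕ.+ r ℕ.* d) ℕ.^ d

  -- A nonempty zero-sum subset is admissible: the constant vector with
  -- entries (|A| − d)/|A| on A lies in P(A, |A| − d).
  zero-sum-admissible : (A : Sel N) → (∀ c → subsetSum A c ≡ + 0) → 1 ℕ.≤ count A → Admissible A
  zero-sum-admissible A zero-sum |A|≥1 _ = point μ (count A) |A|≥1 supported nonneg bounded balanced total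
    where
    e = count A ℕ.∸ d
    μ : Fin N → ℤ
    μ i = 𝟙 (A i) * + e
    supported : ∀ i → A i ≡ false → μ i ≡ + 0
    supported i Ai rewrite Ai = refl
    nonneg : ∀ i → + 0 ≤ μ i
    nonneg i = 0≤* {𝟙 (A i)} {+ e} (𝟙-nonneg (A i)) (+≤+ ℕ.z≤n)
    bounded : ∀ i → μ i ≤ + count A
    bounded i with A i
    ... | true  = subst (_≤ + count A) (sym (ℤP.*-identityˡ (+ e))) (+≤+ (ℕP.m∸n≤m (count A) d))
    ... | false = +≤+ ℕ.z≤n
    balanced : ∀ c → ∑ (λ i → μ i * u i c) ≡ + 0
    balanced c = begin
        ∑ (λ i → μ i * u i c)
      ≡⟨ ∑-cong (λ i → reorder (𝟙 (A i)) (+ e) (u i c)) ⟩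
        ∑ (λ i → + e * (𝟙 (A i) * u i c))
      ≡⟨ ∑-*ˡ (+ e) (λ i → 𝟙 (A i) * u i c) ⟩
        + e * subsetSum A c
      ≡⟨ cong (+ e *_) (zero-sum c) ⟩
        + e * + 0
      ≡⟨ ℤP.*-zeroʳ (+ e) ⟩
        + 0 ∎
      where
      open ≡-Reasoning
      reorder : ∀ a e x → a * e * x ≡ e * (a * x)
      reorder = solve-∀
    total : ∑ μ ≡ + e * + count A
    total = trans (∑-𝟙 A (+ e)) (ℤP.*-comm (+ count A) (+ e))

  difference-zero-sum : ∀ {A B} → B ⊆ A → ∀ c → subsetSum A c ≡ subsetSum B c → subsetSum (A ∖ B) c ≡ + 0
  difference-zero-sum {A} {B} B⊆A c same = ∙-cancelˡ (subsetSum B c) _ _ (begin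
      subsetSum B c + subsetSum (A ∖ B) c
    ≡⟨ sym (∑-⊆ B⊆A (λ i → u i c)) ⟩
      subsetSum A c
    ≡⟨ same ⟩
      subsetSum B c
    ≡⟨ sym (ℤP.+-identityʳ _) ⟩
      subsetSum B c + + 0 ∎)
    where open ≡-Reasoning

  difference-avoids : ∀ {A B} → B ⊆ A → count (B ∩ special) ≡ count (A ∩ special) →
    ∀ i → (A ∖ B) i ≡ true → special i ≡ false
  difference-avoids {A} {B} B⊆A same i i∈A∖B = not-true (special i) λ si → true≢false (in-difference si) (count-zero _ nothing-left i)
    where
    nothing-left : count (A ∩ special ∖ B ∩ special) ≡ 0
    nothing-left = ℕP.+-cancelˡ-≡ (count (B ∩ special)) _ 0
      (trans (sym (count-⊆ (∩-mono {C = special} B⊆A))) (trans (sym same) (sym (ℕP.+-identityʳ _))))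
    in-difference : special i ≡ true → (A ∩ special ∖ B ∩ special) i ≡ true
    in-difference si = restrict (A i) (B i) (special i) i∈A∖B si
      where
      restrict : ∀ a b s → a ∧ not b ≡ true → s ≡ true → (a ∧ s) ∧ not (b ∧ s) ≡ true
      restrict true false true refl refl = refl

  -- The |A| + 1 stages of the Steinitz chain from A have sums
  -- in [-rd, rd]^d; coding each stage by its sum and its number of special
  -- elements, two stages a < b receive the same code, and A_a ∖ A_b works.
  record ZeroSumPart (A : Sel N) : Set where
    field
      part      : Sel N
      part⊆     : part ⊆ A
      avoids    : ∀ i → part i ≡ true → special i ≡ false
      nonempty  : 0 ℕ.< count part
      zero-sum  : ∀ c → subsetSum part c ≡ + 0

  zero-sum-part : (A : Sel N) → (∀ c → subsetSum A c ≡ + 0) → 1 ℕ.≤ count A → (K : ℕ) →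
    count (A ∩ special) ℕ.≤ K → M ℕ.* suc K ℕ.< suc (count A) → ZeroSumPart A
  zero-sum-part A zero-sum |A|≥1 K few-special many = record
    { part = A_ a ∖ A_ b
    ; part⊆ = λ i x → chain-⊆ S a i (∖-⊆ (A_ a) (A_ b) i x)
    ; avoids = difference-avoids (chain-antitone S (ℕP.<⇒≤ a<b)) same-special
    ; nonempty = chain-strict S a<b b≤|A|
    ; zero-sum = λ c → difference-zero-sum (chain-antitone S (ℕP.<⇒≤ a<b)) c (same-sum c)
    }
    where
    S = A , zero-sum-admissible A zero-sum |A|≥1
    A_ : ℕ → Sel N
    A_ = chain S
    special-count< : ∀ t → count (A_ t ∩ special) ℕ.< suc K
    special-count< t = ℕ.s≤s (ℕP.≤-trans (count-mono (∩-mono (chain-⊆ S t))) few-special)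
    code : Fin (suc (count A)) → Fin (M ℕ.* suc K)
    code t = combine (encode (r ℕ.* d) (subsetSum (A_ (toℕ t))) (chain-bounded S (toℕ t)))
                     (fromℕ< (special-count< (toℕ t)))
    collision = FinP.pigeonhole many code
    a = toℕ (proj₁ collision)
    b = toℕ (proj₁ (proj₂ collision))
    a<b : a ℕ.< b
    a<b = proj₁ (proj₂ (proj₂ collision))
    same-code = FinP.combine-injective _ _ _ _ (proj₂ (proj₂ (proj₂ collision)))
    same-sum : ∀ c → subsetSum (A_ a) c ≡ subsetSum (A_ b) c
    same-sum = encode-injective (r ℕ.* d) _ _ (chain-bounded S a) (chain-bounded S b) (proj₁ same-code)
    same-special : count (A_ b ∩ special) ≡ count (A_ a ∩ special)
    same-special = sym (trans (sym (FinP.toℕ-fromℕ< (special-count< a)))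
                        (trans (cong toℕ (proj₂ same-code)) (FinP.toℕ-fromℕ< (special-count< b))))
    b≤|A| : b ℕ.≤ count A
    b≤|A| = ℕP.≤-pred (FinP.toℕ<n (proj₁ (proj₂ collision)))

-- Every x ∈ [-kr, kr] is a sum of k integers in [-r, r]: repeatedly split
-- off the point of [-r, r] nearest to the remainder.
module Pieces (r : ℕ) where

  clamp : ℤ → ℤ
  clamp x with + r ℤ.≤? x
  ... | yes _ = + r
  ... | no _ with x ℤ.≤? - (+ r)
  ... | yes _ = - (+ r)
  ... | no _  = x

  clamp-bounded : ∀ x → Bounded r (clamp x)
  clamp-bounded x with + r ℤ.≤? x
  ... | yes _ = -r≤r , ℤP.≤-refl
    where -r≤r = ℤP.≤-trans (ℤP.neg-mono-≤ (+≤+ ℕ.z≤n)) (+≤+ ℕ.z≤n)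
  ... | no r≰x with x ℤ.≤? - (+ r)
  ... | yes _ = ℤP.≤-refl , ℤP.≤-trans (ℤP.neg-mono-≤ (+≤+ ℕ.z≤n)) (+≤+ ℕ.z≤n)
  ... | no x≰-r = ℤP.<⇒≤ (ℤP.≰⇒> x≰-r) , ℤP.<⇒≤ (ℤP.≰⇒> r≰x)

  clamp-remainder : ∀ J x → + 0 ≤ J → - (+ r + J) ≤ x → x ≤ + r + J → (- J ≤ x - clamp x) × (x - clamp x ≤ J)
  clamp-remainder J x J≥0 lower upper with + r ℤ.≤? x
  ... | yes r≤x =
    ℤP.≤-trans (ℤP.neg-mono-≤ J≥0) (ℤP.i≤j⇒0≤j-i r≤x) ,
    ≤-+ˡ {X = - (+ r)} (shift x (+ r)) (unshift (+ r) J) upper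
    where
    shift : ∀ x r → x - r ≡ - r + x
    shift = solve-∀
    unshift : ∀ r a → a ≡ - r + (r + a)
    unshift = solve-∀
  ... | no _ with x ℤ.≤? - (+ r)
  ... | yes x≤-r =
    ≤-+ˡ {X = + r} (unshift (+ r) J) (shift x (+ r)) lower ,
    ℤP.≤-trans (≤-+ˡ {X = + r} (shift x (+ r)) (cancel (+ r)) x≤-r) J≥0
    where
    unshift : ∀ r a → - a ≡ r + (- (r + a))
    unshift = solve-∀
    shift : ∀ x r → x - - r ≡ r + x
    shift = solve-∀
    cancel : ∀ r → + 0 ≡ r + - r
    cancel = solve-∀
  ... | no _ =
    subst (- J ≤_) (sym (ℤP.+-inverseʳ x)) (ℤP.neg-mono-≤ J≥0) ,
    subst (_≤ J) (sym (ℤP.+-inverseʳ x)) J≥0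

  piece : ℕ → ℤ → ℤ
  piece zero    x = clamp x
  piece (suc t) x = piece t (x - clamp x)

  piece-bounded : ∀ t x → Bounded r (piece t x)
  piece-bounded zero    x = clamp-bounded x
  piece-bounded (suc t) x = piece-bounded t (x - clamp x)

  pieces-sum : ∀ k x → Bounded (k ℕ.* r) x → ∑ {k} (λ t → piece (toℕ t) x) ≡ x
  pieces-sum zero    x (lower , upper) = ℤP.≤-antisym lower upper
  pieces-sum (suc k) x (lower , upper) rewrite ℤP.pos-+ r (k ℕ.* r) =
    trans (cong (λ y → clamp x + y) (pieces-sum k (x - clamp x) (clamp-remainder (+ (k ℕ.* r)) x (+≤+ ℕ.z≤n) lower upper)))
          (add-back (clamp x) x)
    where
    add-back : ∀ c x → c + (x - c) ≡ x
    add-back = solve-∀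

count-++ : ∀ {n k} (A : Sel n) (B : Sel k) → count (A ++ B) ≡ count A ℕ.+ count B
count-++ {n} A B = trans (count-split n (A ++ B))
  (cong₂ ℕ._+_ (count-cong (VecFP.lookup-++ˡ A B)) (count-cong (VecFP.lookup-++ʳ A B)))

lookup-sumSub : ∀ {d n} (s : Fin n → Pt d) (S : Sel n) c →
  lookup (sumSub s (tabulate S)) c ≡ ∑ (λ i → 𝟙 (S i) * lookup (s i) c)
lookup-sumSub {n = zero}  s S c = VecP.lookup-replicate c (+ 0)
lookup-sumSub {n = suc n} s S c with S zero
... | true  = trans (VecP.lookup-zipWith _+_ c (s zero) _)
                (cong₂ _+_ (sym (ℤP.*-identityˡ (lookup (s zero) c))) (lookup-sumSub (λ i → s (suc i)) (λ i → S (suc i)) c))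
... | false = trans (lookup-sumSub (λ i → s (suc i)) (λ i → S (suc i)) c) (sym (ℤP.+-identityˡ _))

sumSeq-all : ∀ {d n} (s : Fin n → Pt d) → sumSeq s ≡ sumSub s (tabulate (λ _ → true))
sumSeq-all {n = zero}  s = refl
sumSeq-all {n = suc n} s = cong (s zero +ᵈ_) (sumSeq-all (λ i → s (suc i)))

∣tabulate∣ : ∀ {n} (S : Sel n) → ∣ tabulate S ∣ ≡ count S
∣tabulate∣ {zero}  S = refl
∣tabulate∣ {suc n} S with S zero
... | true  = cong suc (∣tabulate∣ (λ i → S (suc i)))
... | false = ∣tabulate∣ (λ i → S (suc i))

lookup-ext : ∀ {d} (v w : Pt d) → (∀ c → lookup v c ≡ lookup w c) → v ≡ w
lookup-ext v w e = trans (sym (VecP.tabulate∘lookup v)) (trans (VecP.tabulate-cong e) (VecP.tabulate∘lookup w))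

ceilDiv-cover : ∀ q r → .{{_ : NonZero r}} → q ℕ.≤ ceilDiv q r ℕ.* r
ceilDiv-cover q (suc r′) = ℕP.+-cancelʳ-≤ r′ q (ceilDiv q (suc r′) ℕ.* suc r′) (begin
    q ℕ.+ r′
  ≡⟨ m≡m%n+[m/n]*n (q ℕ.+ r′) (suc r′) ⟩
    (q ℕ.+ r′) % suc r′ ℕ.+ ceilDiv q (suc r′) ℕ.* suc r′
  ≤⟨ ℕP.+-monoˡ-≤ _ (ℕP.≤-pred (m%n<n (q ℕ.+ r′) (suc r′))) ⟩
    r′ ℕ.+ ceilDiv q (suc r′) ℕ.* suc r′
  ≡⟨ ℕP.+-comm r′ _ ⟩
    ceilDiv q (suc r′) ℕ.* suc r′ ℕ.+ r′ ∎)
  where open ℕP.≤-Reasoning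

codes≡ : ∀ r d → suc (r ℕ.* d ℕ.+ r ℕ.* d) ℕ.^ d ≡ (2 ℕ.* r ℕ.* d ℕ.+ 1) ℕ.^ d
codes≡ r d = cong (ℕ._^ d) (base r d)
  where
  base : ∀ r d → suc (r ℕ.* d ℕ.+ r ℕ.* d) ≡ 2 ℕ.* r ℕ.* d ℕ.+ 1
  base = ℕSolver.solve-∀

module Shortening (r d q : ℕ) .{{_ : NonZero r}} (n : ℕ) (s : Fin n → Pt d)
                  (s-bounded : ∀ i → InBox r (s i)) (z-bounded : InBox q (sumSeq s)) where
  open Pieces r

  k = ceilDiv q r

  z : Fin d → ℤ
  z c = lookup (sumSeq s) c

  partialSum : Sel n → Fin d → ℤ
  partialSum S c = ∑ (λ i → 𝟙 (S i) * lookup (s i) c)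

  -- The sequence followed by k special vectors in [-r, r]^d summing to −z.
  u : Fin (n ℕ.+ k) → Fin d → ℤ
  u i c = ((λ j → lookup (s j) c) ++ (λ t → piece (toℕ t) (- z c))) i

  special : Sel (n ℕ.+ k)
  special = (λ (_ : Fin n) → false) ++ (λ (_ : Fin k) → true)

  u-bounded : ∀ i c → Bounded r (u i c)
  u-bounded i c with splitAt n i
  ... | inj₁ j = s-bounded j c
  ... | inj₂ t = piece-bounded (toℕ t) (- z c)

  open SteinitzChain u r u-bounded using (subsetSum)
  open ZeroSum u r u-bounded special using (M; ZeroSumPart; zero-sum-part)

  subsetSum-split : ∀ A c → subsetSum A c ≡
    partialSum (λ i → A (i ↑ˡ k)) c + ∑ (λ t → 𝟙 (A (n ↑ʳ t)) * piece (toℕ t) (- z c))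
  subsetSum-split A c = trans (∑-split n {k} (λ i → 𝟙 (A i) * u i c)) (cong₂ _+_
    (∑-cong (λ i → cong (𝟙 (A (i ↑ˡ k)) *_) (VecFP.lookup-++ˡ (λ j → lookup (s j) c) (λ t → piece (toℕ t) (- z c)) i)))
    (∑-cong (λ t → cong (𝟙 (A (n ↑ʳ t)) *_) (VecFP.lookup-++ʳ (λ j → lookup (s j) c) (λ t → piece (toℕ t) (- z c)) t))))

  augment : Sel n → Sel (n ℕ.+ k)
  augment S = S ++ (λ _ → true)

  -- The special vectors sum to −z, since z ∈ [-q, q]^d ⊆ [-kr, kr]^d.
  specials-sum : ∀ (S : Sel n) c → ∑ (λ t → 𝟙 (augment S (n ↑ʳ t)) * piece (toℕ t) (- z c)) ≡ - z c
  specials-sum S c = trans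
    (∑-cong {k} (λ t → trans (cong (λ b → 𝟙 b * piece (toℕ t) (- z c)) (VecFP.lookup-++ʳ S (λ _ → true) t)) (ℤP.*-identityˡ (piece (toℕ t) (- z c)))))
    (pieces-sum k (- z c) (-z-bounded (z-bounded c)))
    where
    q≤kr : + q ≤ + (k ℕ.* r)
    q≤kr = +≤+ (ceilDiv-cover q r)
    -z-bounded : ∀ {x} → (- (+ q) ≤ x) × (x ≤ + q) → Bounded (k ℕ.* r) (- x)
    -z-bounded {x} (lower , upper) =
      ℤP.neg-mono-≤ (ℤP.≤-trans upper q≤kr) ,
      ℤP.≤-trans (subst (- x ≤_) (ℤP.neg-involutive (+ q)) (ℤP.neg-mono-≤ lower)) q≤kr

  augment-zero-sum : ∀ S → (∀ c → partialSum S c ≡ z c) → ∀ c → subsetSum (augment S) c ≡ + 0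
  augment-zero-sum S sum-z c = begin
      subsetSum (augment S) c
    ≡⟨ subsetSum-split (augment S) c ⟩
      partialSum (λ i → augment S (i ↑ˡ k)) c + ∑ (λ t → 𝟙 (augment S (n ↑ʳ t)) * piece (toℕ t) (- z c))
    ≡⟨ cong₂ _+_ (∑-cong (λ i → cong (λ b → 𝟙 b * lookup (s i) c) (VecFP.lookup-++ˡ S _ i))) (specials-sum S c) ⟩
      partialSum S c - z c
    ≡⟨ cong (_- z c) (sum-z c) ⟩
      z c - z c
    ≡⟨ ℤP.+-inverseʳ (z c) ⟩
      + 0 ∎
    where open ≡-Reasoning

  augment-count : ∀ S → count (augment S) ≡ count S ℕ.+ k
  augment-count S = trans (count-++ {n} {k} S (λ _ → true)) (cong (count S ℕ.+_) (count-full k))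

  augment-special : ∀ S → count (augment S ∩ special) ℕ.≤ k
  augment-special S = begin
      count (augment S ∩ special)
    ≤⟨ count-mono {A = special} {B = augment S ∩ special} (λ i x → proj₂ (∧-true {augment S i} x)) ⟩
      count special
    ≡⟨ count-++ {n} {k} (λ _ → false) (λ _ → true) ⟩
      count {n} (λ _ → false) ℕ.+ count {k} (λ _ → true)
    ≡⟨ cong₂ ℕ._+_ (count-empty {n} (λ _ → false) (λ _ → refl)) (count-full k) ⟩
      k ∎
    where open ℕP.≤-Reasoning

  codes≤bound : M ℕ.* suc k ℕ.≤ bound r d q
  codes≤bound = begin
      M ℕ.* suc k
    ≤⟨ ℕP.*-monoʳ-≤ M (ℕP.n≤1+n (suc k)) ⟩
      M ℕ.* (2 ℕ.+ k)
    ≡⟨ cong₂ ℕ._*_ (codes≡ r d) (ℕP.+-comm 2 k) ⟩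
      (2 ℕ.* r ℕ.* d ℕ.+ 1) ℕ.^ d ℕ.* (k ℕ.+ 2)
    ≡⟨ ℕP.*-comm _ (k ℕ.+ 2) ⟩
      bound r d q ∎
    where open ℕP.≤-Reasoning

  remove-zero-sum : ∀ {S T} → T ⊆ S → (∀ c → partialSum T c ≡ + 0) → 1 ℕ.≤ count T →
    count (S ∖ T) ℕ.< count S × (∀ c → partialSum (S ∖ T) c ≡ partialSum S c)
  remove-zero-sum {S} {T} T⊆S T-zero-sum |T|≥1 = shorter , same-sum
    where
    shorter : count (S ∖ T) ℕ.< count S
    shorter = subst (count (S ∖ T) ℕ.<_) (sym (trans (count-⊆ T⊆S) (ℕP.+-comm (count T) _)))
                    (ℕP.m<m+n (count (S ∖ T)) |T|≥1)
    same-sum : ∀ c → partialSum (S ∖ T) c ≡ partialSum S c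
    same-sum c = begin
        partialSum (S ∖ T) c
      ≡⟨ sym (ℤP.+-identityˡ _) ⟩
        + 0 + partialSum (S ∖ T) c
      ≡⟨ cong (_+ partialSum (S ∖ T) c) (sym (T-zero-sum c)) ⟩
        partialSum T c + partialSum (S ∖ T) c
      ≡⟨ sym (∑-⊆ T⊆S (λ i → lookup (s i) c)) ⟩
        partialSum S c ∎
      where open ≡-Reasoning

  -- A subsequence with sum z that is longer than the bound contains a
  -- strictly shorter one with sum z: its augmentation is a zero-sum family to
  -- which the zero-sum lemma applies, and the resulting zero-sum part avoids
  -- the special vectors, so it is a nonempty zero-sum subsequence of S.
  shorten : (S : Sel n) → (∀ c → partialSum S c ≡ z c) → bound r d q ℕ.< count S →
    Σ[ S′ ∈ Sel n ] (count S′ ℕ.< count S × (∀ c → partialSum S′ c ≡ z c))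
  shorten S sum-z long =
    S ∖ T , proj₁ removed , λ c → trans (proj₂ removed c) (sum-z c)
    where
    |S|≤|augment| : count S ℕ.≤ count (augment S)
    |S|≤|augment| = subst (count S ℕ.≤_) (sym (augment-count S)) (ℕP.m≤m+n (count S) k)
    enough : M ℕ.* suc k ℕ.< suc (count (augment S))
    enough = ℕ.s≤s (ℕP.≤-trans codes≤bound (ℕP.≤-trans (ℕP.<⇒≤ long) |S|≤|augment|))
    |augment|≥1 : 1 ℕ.≤ count (augment S)
    |augment|≥1 = ℕP.≤-trans (ℕP.≤-trans (ℕ.s≤s ℕ.z≤n) long) |S|≤|augment|

    open ZeroSumPart (zero-sum-part (augment S) (augment-zero-sum S sum-z) |augment|≥1 k (augment-special S) enough)

    T : Sel n
    T i = part (i ↑ˡ k)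
    T⊆S : T ⊆ S
    T⊆S i x = trans (sym (VecFP.lookup-++ˡ S _ i)) (part⊆ (i ↑ˡ k) x)
    no-specials : ∀ t → part (n ↑ʳ t) ≡ false
    no-specials t = not-true (part (n ↑ʳ t))
      (λ x → true≢false (VecFP.lookup-++ʳ (λ (_ : Fin n) → false) (λ (_ : Fin k) → true) t) (avoids (n ↑ʳ t) x))

    T-zero-sum : ∀ c → partialSum T c ≡ + 0
    T-zero-sum c = begin
        partialSum T c
      ≡⟨ sym (ℤP.+-identityʳ _) ⟩
        partialSum T c + + 0
      ≡⟨ cong (λ x → partialSum T c + x) (sym (∑-zero _ (λ t → cong (λ b → 𝟙 b * piece (toℕ t) (- z c)) (no-specials t)))) ⟩
        partialSum T c + ∑ (λ t → 𝟙 (part (n ↑ʳ t)) * piece (toℕ t) (- z c))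
      ≡⟨ sym (subsetSum-split part c) ⟩
        subsetSum part c
      ≡⟨ zero-sum c ⟩
        + 0 ∎
      where open ≡-Reasoning

    |T|≥1 : 1 ℕ.≤ count T
    |T|≥1 = subst (1 ℕ.≤_)
      (trans (count-split n part) (trans (cong (count T ℕ.+_) (count-empty _ no-specials)) (ℕP.+-identityʳ _)))
      nonempty

    removed = remove-zero-sum T⊆S T-zero-sum |T|≥1

  shortest : (fuel : ℕ) (S : Sel n) → count S ℕ.≤ fuel → (∀ c → partialSum S c ≡ z c) →
    Σ[ S′ ∈ Sel n ] (count S′ ℕ.≤ bound r d q × (∀ c → partialSum S′ c ≡ z c))
  shortest zero       S |S|≤0    sum-z = S , ℕP.≤-trans |S|≤0 ℕ.z≤n , sum-z
  shortest (suc fuel) S |S|≤1+fuel sum-z with count S ℕ.≤? bound r d q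
  ... | yes short = S , short , sum-z
  ... | no  long  = shortest fuel (proj₁ S′) (ℕP.≤-pred (ℕP.≤-trans (proj₁ (proj₂ S′)) |S|≤1+fuel)) (proj₂ (proj₂ S′))
    where
    S′ = shorten S sum-z (ℕP.≰⇒> long)

  whole-sum : ∀ c → partialSum (λ _ → true) c ≡ z c
  whole-sum c = sym (trans (cong (λ v → lookup v c) (sumSeq-all s)) (lookup-sumSub s (λ _ → true) c))

corollary2p2 : (r d q : ℕ) → .{{_ : NonZero r}} → NonZero d → NonZero q →
    (n : ℕ) → bound r d q ℕ.≤ n →
    (s : Fin n → Pt d) → (∀ i → InBox r (s i)) → InBox q (sumSeq s) →
    Σ (Subset n) (λ S → (∣ S ∣ ℕ.≤ bound r d q) × (sumSub s S ≡ sumSeq s))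
corollary2p2 r d q _ _ n _ s s-bounded z-bounded =
  tabulate S , subst (ℕ._≤ bound r d q) (sym (∣tabulate∣ S)) short , lookup-ext _ _ same-sum
  where
  open Shortening r d q n s s-bounded z-bounded
  shortened = shortest n (λ _ → true) (count-≤ _) whole-sum
  S = proj₁ shortened
  short = proj₁ (proj₂ shortened)
  same-sum : ∀ c → lookup (sumSub s (tabulate S)) c ≡ lookup (sumSeq s) c
  same-sum c = trans (lookup-sumSub s S c) (proj₂ (proj₂ shortened) c)
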